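{- In $\mathrm{ord}$ the following hold. (1) If $\alpha,\beta\in\mathrm{ord}$ satisfy $\mathrm{In}_\alpha=\mathrm{In}_\beta$ and $\alpha_i\le\beta_i$ for all $i\in\mathrm{In}_\alpha$, then $\alpha\le\beta$. (2) If $\alpha,\beta\in\mathrm{ord}^*$ satisfy $\mathrm{In}_\alpha=\mathrm{In}_\beta$, the $\alpha_i$ and $\beta_i$ lie in $\mathrm{ord}^*$, and $\alpha_i\le\beta_i$ for all $i\in\mathrm{In}_\alpha$, then $\sup(\alpha_i)_{i\in\mathrm{In}_\alpha}\le\sup(\beta_i)_{i\in\mathrm{In}_\beta}$; the same holds for the sup of finite families in $\mathrm{ord}$. (3) For all $\alpha\in\mathrm{ord}$, $\alpha\le\alpha$; a fortiori $\alpha\le\alpha,\beta^1,\dots,\beta^m$ for any $\beta^1,\dots,\beta^m\in\mathrm{ord}$. (4) For all $\alpha\in\mathrm{ord}^*$ and all $i\in\mathrm{In}_\alpha$, $\alpha_i<\alpha$; a fortiori $\alpha_i<\alpha,\beta^1,\dots,\beta^m$. (5) For all $\alpha\in\mathrm{ord}$, $\alpha<\alpha$ is impossible. (6) For all $\alpha\in\mathrm{ord}$, $\alpha<\mathrm{suc}(\alpha)$. (7) For $\alpha,\beta\in\mathrm{ord}$: if $\gamma<\beta$ for all $\gamma\in\mathrm{ord}$ with $\gamma<\alpha$, then $\alpha\le\beta$.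
   Context: The setting is constructive (intuitionistic logic). Let $\mathfrak F$ be a set of index sets containing $\mathbb N$ and every $\mathbb N_k=\{n\in\mathbb N:n<k\}$ ($k\ge0$), closed (up to isomorphism) under finitely enumerated subsets, sets of finitely enumerated subsets, and disjoint unions indexed by elements of $\mathfrak F$. The set $\mathrm{ord}=\mathrm{ord}_{\mathfrak F}$ is defined inductively: it has a distinguished element $\underline 0$, and for every $I\in\mathfrak F$ and every family $(\alpha_i)_{i\in I}$ in $\mathrm{ord}$ an element $\mathrm S(\alpha_i)_{i\in I}$; $\mathrm{ord}^*$ is the set of elements of this second kind. For $\alpha=\mathrm S(\alpha_i)_{i\in I}$, $\mathrm{In}_\alpha=I$ and the $\alpha_i$ are its definitional subordinals; by convention $\mathrm{In}_{\underline0}=\emptyset$. For a finite list $F\subseteq_f\mathrm{In}_\alpha$, $\alpha_F$ is the list of the $\alpha_i$, $i\in F$. By simultaneous induction ($m\ge1$): $\alpha\le\beta^1,\dots,\beta^m$ means $\alpha_i<\beta^1,\dots,\beta^m$ for all $i\in\mathrm{In}_\alpha$; $\alpha<\beta^1,\dots,\beta^m$ means there exist $F_k\subseteq_f\mathrm{In}_{\beta^k}$, not all empty, with $\alpha\le\beta^1_{F_1},\dots,\beta^m_{F_m}$. $\mathrm{suc}(\alpha)$ is $\mathrm S(\beta_i)_{i\in\mathbb N_1}$ with $\beta_0=\alpha$. For a family $(\alpha^j)_{j\in J}$ in $\mathrm{ord}^*$ with $\alpha^j=\mathrm S((\alpha^j)_i)_{i\in I_j}$, $\sup(\alpha^j)_{j\in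 J}=\mathrm S(\varepsilon_k)_{k\in K}$ with $K$ the disjoint union of the $I_j$ and $\varepsilon_k=(\alpha^j)_i$ when $k$ is the image of $i\in I_j$. For a finite family in $\mathrm{ord}$, $\sup(\alpha^1,\dots,\alpha^r)$ is $\underline0$ if all $\alpha^k=\underline0$, else the sup of those $\alpha^k\in\mathrm{ord}^*$. -}

module Defs where

import Data.Nat
open import Data.Nat using (ℕ; zero; suc)
open import Data.Fin using (Fin)
open import Data.List using (List; []; _∷_; _++_; map; length)
open import Data.List.Membership.Propositional using (_∈_)
open import Data.Product using (Σ; _×_; _,_; proj₁; proj₂)
open import Data.Sum using (_⊎_)
open import Data.Unit using (⊤)
open import Data.Empty using (⊥)
open import Function.Bundles using (_↔_; Inverse)

-- The class 𝔉 of index sets, presented as a universe (codes + decoding)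
-- with the closure properties required in the paper (up to isomorphism).

record IndexSets : Set₁ where
  field
    Code : Set
    El   : Code → Set
    ℕc     : Code
    ℕc-iso : El ℕc ↔ ℕ
    ℕ<c     : ℕ → Code
    ℕ<c-iso : ∀ k → El (ℕ<c k) ↔ Σ ℕ (λ n → n Data.Nat.< k)
    subc     : (I : Code) → List (El I) → Code
    subc-iso : ∀ I (l : List (El I)) → El (subc I l) ↔ Σ (El I) (λ i → i ∈ l)
    finsubc     : Code → Code
    finsubc-iso : ∀ I → El (finsubc I) ↔ List (El I)
    Σc     : (I : Code) → (El I → Code) → Code
    Σc-iso : ∀ I (J : El I → Code) → El (Σc I J) ↔ Σ (El I) (λ i → El (J i))

module OrdTheory (𝔉 : IndexSets) where
  open IndexSets 𝔉

  data Ord : Set where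
    𝟘 : Ord
    S : (I : Code) → (El I → Ord) → Ord

  IsS : Ord → Set
  IsS 𝟘       = ⊥
  IsS (S _ _) = ⊤

  In : Ord → Set
  In 𝟘       = ⊥
  In (S I _) = El I

  sub : (α : Ord) → In α → Ord
  sub (S _ f) i = f i

  -- a choice of finite lists F_k ⊆_f In_{β^k}, one for each β^k of the list
  Choice : List Ord → Set
  Choice []       = ⊤
  Choice (β ∷ βs) = List (In β) × Choice βs

  NotAllEmpty : (βs : List Ord) → Choice βs → Set
  NotAllEmpty []       _        = ⊥
  NotAllEmpty (β ∷ βs) (F , Fs) = (0 Data.Nat.< length F) ⊎ NotAllEmpty βs Fs

  picks : (βs : List Ord) → Choice βs → List Ord
  picks []       _        = []
  picks (β ∷ βs) (F , Fs) = map (sub β) F ++ picks βs Fs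

  _≤*_ : Ord → List Ord → Set
  _<*_ : Ord → List Ord → Set
  𝟘     ≤* βs = ⊤
  S I f ≤* βs = (i : El I) → f i <* βs
  α <* βs = Σ (Choice βs) (λ F → NotAllEmpty βs F × (α ≤* picks βs F))

  _≤_ : Ord → Ord → Set
  α ≤ β = α ≤* (β ∷ [])

  _<_ : Ord → Ord → Set
  α < β = α <* (β ∷ [])

  sucO : Ord → Ord
  sucO α = S (ℕ<c 1) (λ _ → α)

  -- elements of ord* given by their index set and family
  Star : Set
  Star = Σ Code (λ I → El I → Ord)

  toStar : (α : Ord) → IsS α → Star
  toStar (S I f) _ = I , f

  supStar : (J : Code) → (El J → Star) → Ord
  supStar J a = S (Σc J (λ j → proj₁ (a j))) ε
    where
    ε : El (Σc J (λ j → proj₁ (a j))) → Ord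
    ε k = proj₂ (a (proj₁ p)) (proj₂ p)
      where p = Inverse.to (Σc-iso J (λ j → proj₁ (a j))) k

  sup : (J : Code) (a : El J → Ord) → ((j : El J) → IsS (a j)) → Ord
  sup J a p = supStar J (λ j → toStar (a j) (p j))

  supSub : (α : Ord) → IsS α → ((i : In α) → IsS (sub α i)) → Ord
  supSub (S I f) _ q = sup I f q

  stars : List Ord → List Star
  stars []            = []
  stars (𝟘 ∷ xs)      = stars xs
  stars (S I f ∷ xs)  = (I , f) ∷ stars xs

  lookupL : (ys : List Star) → Σ ℕ (λ n → n Data.Nat.< length ys) → Star
  lookupL []       (_ , ())
  lookupL (y ∷ ys) (zero  , _) = y
  lookupL (y ∷ ys) (suc n , Data.Nat.s≤s n<) = lookupL ys (n , n<)

  supStars : List Star → Ord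
  supStars []         = 𝟘
  supStars ys@(_ ∷ _) =
    supStar (ℕ<c (length ys)) (λ j → lookupL ys (Inverse.to (ℕ<c-iso (length ys)) j))

  -- sup(α¹,…,αʳ): 𝟘 if all αᵏ = 𝟘, else the sup of those αᵏ ∈ ord*
  supFin : List Ord → Ord
  supFin xs = supStars (stars xs)

{-# OPTIONS --safe #-}
-- Everything except irreflexivity follows from the description of α <* βs as
-- "α ≤* L for some nonempty list L of definitional subordinals of members of
-- βs", which also makes <* monotone in the set of subordinals of βs; this
-- settles the sups, whose subordinals are those of their members.
-- Irreflexivity: if every member of a nonempty list L is <* L, merging the
-- witnessing lists yields such a list M of subordinals of members of L.  This
-- descent is impossible, since a list is accessible for "M consists of
-- subordinals of members of L" as soon as its singletons are, and singletons
-- are accessible by induction on ord.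
module Submission where

open import Defs
open import Data.List using (List; []; _∷_)
open import Data.List.Relation.Binary.Pointwise using (Pointwise)
open import Data.Product using (_×_)
open import Relation.Nullary using (¬_)
open import Relation.Binary.PropositionalEquality using (_≡_; subst)
open import Function using (id)

open import Data.Nat using (zero; suc; z≤n; s≤s)
open import Data.List using ([_]; _++_; map; length)
open import Data.List.Relation.Binary.Pointwise using ([]; _∷_)
open import Data.List.Relation.Unary.All as All using (All; []; _∷_)
open import Data.List.Relation.Unary.All.Properties using () renaming (++⁺ to All-++⁺; map⁺ to All-map⁺)
open import Data.List.Relation.Unary.Any as Any using (Any; here; there)
open import Data.List.Relation.Unary.Any.Properties using (¬Any[]) renaming (++⁻ to Any-++⁻)
open import Data.List.Membership.Propositional using (_∈_)
open import Data.List.Membership.Propositional.Properties using (∈-++⁺ˡ; ∈-++⁺ʳ)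
open import Data.List.Relation.Binary.Subset.Propositional using (_⊆_)
open import Data.List.Relation.Binary.Subset.Propositional.Properties
  using (Any-resp-⊆; map⁺; ++⁺; ++⁺ʳ; xs⊆xs++ys; xs⊆ys++xs; xs⊆x∷xs; ∷⁺ʳ; ∈-∷⁺ʳ)
open import Data.Product using (Σ-syntax; ∃; _,_; proj₁; proj₂)
open import Data.Sum using (inj₁; inj₂)
open import Data.Unit using (tt)
open import Data.Empty using (⊥-elim)
open import Induction.WellFounded using (Acc; acc; WellFounded)
open import Relation.Binary.PropositionalEquality using (refl; sym; cong)
open import Function.Bundles using (Inverse)

module OrdProperties (𝔉 : IndexSets) where
  open IndexSets 𝔉
  open OrdTheory 𝔉

  _≺_ : Ord → List Ord → Set
  y ≺ βs = Any (λ x → ∃ λ (i : In x) → sub x i ≡ y) βs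

  ∈⇒sub-≺ : ∀ {x βs} → x ∈ βs → (i : In x) → sub x i ≺ βs
  ∈⇒sub-≺ m i = Any.map (λ { refl → i , refl }) m

  ∅ : (βs : List Ord) → Choice βs
  ∅ []       = tt
  ∅ (_ ∷ βs) = [] , ∅ βs

  single : ∀ {y βs} → y ≺ βs → Choice βs
  single {βs = _ ∷ βs} (here (i , _)) = i ∷ [] , ∅ βs
  single               (there p)      = [] , single p

  _∪_ : ∀ {βs} → Choice βs → Choice βs → Choice βs
  _∪_ {[]}    _        _        = tt
  _∪_ {_ ∷ _} (F , Fs) (G , Gs) = F ++ G , Fs ∪ Gs

  ∈-picks-single : ∀ {y βs} (p : y ≺ βs) → y ∈ picks βs (single p)
  ∈-picks-single (here (i , refl)) = here refl
  ∈-picks-single (there p)         = ∈-picks-single p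

  picks-∪ˡ : ∀ βs (F G : Choice βs) → picks βs F ⊆ picks βs (F ∪ G)
  picks-∪ˡ []       _        _        ()
  picks-∪ˡ (β ∷ βs) (F , Fs) (G , Gs) =
    ++⁺ (map⁺ (sub β) (xs⊆xs++ys F G)) (picks-∪ˡ βs Fs Gs)

  picks-∪ʳ : ∀ βs (F G : Choice βs) → picks βs G ⊆ picks βs (F ∪ G)
  picks-∪ʳ []       _        _        ()
  picks-∪ʳ (β ∷ βs) (F , Fs) (G , Gs) =
    ++⁺ (map⁺ (sub β) (xs⊆ys++xs G F)) (picks-∪ʳ βs Fs Gs)

  picks-≺ : ∀ βs (F : Choice βs) → All (_≺ βs) (picks βs F)
  picks-≺ []       _        = []
  picks-≺ (β ∷ βs) (F , Fs) =
    All-++⁺ (All-map⁺ (All.tabulate λ {i} _ → here (i , refl))) (All.map there (picks-≺ βs Fs))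

  ∈-picks⇒NotAllEmpty : ∀ βs (F : Choice βs) {y} → y ∈ picks βs F → NotAllEmpty βs F
  ∈-picks⇒NotAllEmpty []       _            ()
  ∈-picks⇒NotAllEmpty (β ∷ βs) ([] , Fs)    m = inj₂ (∈-picks⇒NotAllEmpty βs Fs m)
  ∈-picks⇒NotAllEmpty (β ∷ βs) (_ ∷ _ , Fs) _ = inj₁ (s≤s z≤n)

  NotAllEmpty⇒∃-∈-picks : ∀ βs (F : Choice βs) → NotAllEmpty βs F → ∃ (_∈ picks βs F)
  NotAllEmpty⇒∃-∈-picks []       _            ()
  NotAllEmpty⇒∃-∈-picks (β ∷ βs) ([] , _)     (inj₁ ())
  NotAllEmpty⇒∃-∈-picks (β ∷ βs) (i ∷ _ , _)  (inj₁ _)  = sub β i , here refl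
  NotAllEmpty⇒∃-∈-picks (β ∷ βs) (F , Fs)     (inj₂ ne) =
    let y , m = NotAllEmpty⇒∃-∈-picks βs Fs ne in y , ∈-++⁺ʳ (map (sub β) F) m

  cover : ∀ {βs L} → All (_≺ βs) L → Σ[ G ∈ Choice βs ] L ⊆ picks βs G
  cover {βs} []       = ∅ βs , λ ()
  cover {βs} (p ∷ ps) =
    let G , L⊆ = cover ps
    in  single p ∪ G ,
        ∈-∷⁺ʳ (picks-∪ˡ βs (single p) G (∈-picks-single p)) (λ m → picks-∪ʳ βs (single p) G (L⊆ m))

  <*-elim : ∀ {α βs} → α <* βs → Σ[ L ∈ List Ord ] ∃ (_∈ L) × All (_≺ βs) L × α ≤* L
  <*-elim {βs = βs} (F , ne , h) = picks βs F , NotAllEmpty⇒∃-∈-picks βs F ne , picks-≺ βs F , h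

  mutual
    ≤*-⊆ : ∀ {α xs ys} → xs ⊆ ys → α ≤* xs → α ≤* ys
    ≤*-⊆ {𝟘}     _ _   = tt
    ≤*-⊆ {S _ _} s h i = <*-≺-mono (Any-resp-⊆ s) (h i)

    <*-intro : ∀ {α βs L y} → y ∈ L → All (_≺ βs) L → α ≤* L → α <* βs
    <*-intro {βs = βs} m ch h =
      let G , L⊆ = cover ch in G , ∈-picks⇒NotAllEmpty βs G (L⊆ m) , ≤*-⊆ L⊆ h

    <*-≺-mono : ∀ {α xs ys} → (∀ {y} → y ≺ xs → y ≺ ys) → α <* xs → α <* ys
    <*-≺-mono f h = let L , (_ , m) , ch , le = <*-elim h in <*-intro m (All.map f ch) le

  ≤*⇒sub-<* : ∀ {α βs} → α ≤* βs → (i : In α) → sub α i <* βs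
  ≤*⇒sub-<* {S _ _} h = h

  ≤*-∈ : ∀ {α βs} → α ∈ βs → α ≤* βs
  ≤*-∈ {𝟘}     _   = tt
  ≤*-∈ {S _ _} m i = <*-intro (here refl) (∈⇒sub-≺ m i ∷ []) (≤*-∈ (here refl))

  ≤*-head : ∀ α βs → α ≤* (α ∷ βs)
  ≤*-head α βs = ≤*-∈ (here refl)

  sub-<*-head : ∀ α (i : In α) βs → sub α i <* (α ∷ βs)
  sub-<*-head α i βs = ≤*⇒sub-<* (≤*-head α βs) i

  ≤-refl : ∀ α → α ≤ α
  ≤-refl α = ≤*-head α []

  ≤-sub⇒< : ∀ {γ β} (j : In β) → γ ≤ sub β j → γ < β
  ≤-sub⇒< {γ} {β} j = <*-intro {γ} {[ β ]} {[ sub β j ]} (here refl) (here (j , refl) ∷ [])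

  ≤-pointwise : ∀ α β (e : In α ≡ In β) →
    ((i : In α) → sub α i ≤ sub β (subst id e i)) → α ≤ β
  ≤-pointwise 𝟘       _ _ _   = tt
  ≤-pointwise (S _ _) β e h i = ≤-sub⇒< {β = β} (subst id e i) (h i)

  <-suc : ∀ α → α < sucO α
  <-suc α = sub-<*-head (sucO α) (Inverse.from (ℕ<c-iso 1) (0 , s≤s z≤n)) []

  <-⊆⇒≤ : ∀ α β → (∀ γ → γ < α → γ < β) → α ≤ β
  <-⊆⇒≤ 𝟘       _ _   = tt
  <-⊆⇒≤ (S I f) _ h i = h (f i) (sub-<*-head (S I f) i [])

  -- Without the nonemptiness of M, [] ◁ [] would hold.
  _◁_ : List Ord → List Ord → Set
  M ◁ L = ∃ (_∈ M) × All (_≺ L) M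

  acc-⊆ : ∀ {L M} → L ⊆ M → Acc _◁_ M → Acc _◁_ L
  acc-⊆ s (acc rs) = acc λ (ne , ch) → rs (ne , All.map (Any-resp-⊆ s) ch)

  acc-[] : Acc _◁_ []
  acc-[] = acc λ ((_ , m) , ch) → ⊥-elim (¬Any[] (All.lookup ch m))

  acc-≺ : ∀ {L M} → Acc _◁_ L → All (_≺ L) M → Acc _◁_ M
  acc-≺ _        []         = acc-[]
  acc-≺ (acc rs) ch@(_ ∷ _) = rs ((_ , here refl) , ch)

  split-≺ : ∀ A {B N} → All (_≺ (A ++ B)) N →
    Σ[ NA ∈ List Ord ] Σ[ NB ∈ List Ord ] All (_≺ A) NA × All (_≺ B) NB × N ⊆ NA ++ NB
  split-≺ A []       = [] , [] , [] , [] , λ ()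
  split-≺ A (p ∷ ps) with Any-++⁻ A p | split-≺ A ps
  ... | inj₁ pA | NA , NB , chA , chB , s = _ ∷ NA , NB , pA ∷ chA , chB , ∷⁺ʳ _ s
  ... | inj₂ pB | NA , NB , chA , chB , s =
    NA , _ ∷ NB , chA , pB ∷ chB ,
    ∈-∷⁺ʳ (∈-++⁺ʳ NA (here refl)) (λ m → ++⁺ʳ NA (xs⊆x∷xs NB _) (s m))

  acc-++ : ∀ {A B} → Acc _◁_ A → Acc _◁_ B → Acc _◁_ (A ++ B)
  acc-++ {A} {B} (acc rs) accB = acc below
    where
    below : ∀ {N} → N ◁ (A ++ B) → Acc _◁_ N
    below (_ , ch) with split-≺ A ch
    ... | []    , _ , _   , chB , s = acc-⊆ s (acc-≺ accB chB)
    ... | _ ∷ _ , _ , chA , chB , s =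
      acc-⊆ s (acc-++ (rs ((_ , here refl) , chA)) (acc-≺ accB chB))

  acc-All : ∀ {L} → All (λ x → Acc _◁_ [ x ]) L → Acc _◁_ L
  acc-All []       = acc-[]
  acc-All (a ∷ as) = acc-++ a (acc-All as)

  mutual
    acc-[_] : ∀ x → Acc _◁_ [ x ]
    acc-[ x ] = acc λ (_ , ch) → acc-All (All.map (acc-subordinal x) ch)

    acc-subordinal : ∀ x {y} → y ≺ [ x ] → Acc _◁_ [ y ]
    acc-subordinal 𝟘       (here (() , _))
    acc-subordinal (S _ f) (here (i , refl)) = acc-[ f i ]

  ◁-wellFounded : WellFounded _◁_
  ◁-wellFounded L = acc-All (All.tabulate λ {x} _ → acc-[ x ])

  merge-bounds : ∀ {βs L} → All (_<* βs) L →
    Σ[ M ∈ List Ord ] All (_≺ βs) M × All (_≤* M) L × (∃ (_∈ L) → ∃ (_∈ M))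
  merge-bounds []       = [] , [] , [] , λ { (_ , ()) }
  merge-bounds (h ∷ hs) with <*-elim h | merge-bounds hs
  ... | Lh , (y , m) , chh , leh | M , chM , leM , _ =
    Lh ++ M , All-++⁺ chh chM ,
    ≤*-⊆ (xs⊆xs++ys Lh M) leh ∷ All.map (≤*-⊆ (xs⊆ys++xs M Lh)) leM ,
    λ _ → y , ∈-++⁺ˡ m

  ≺⇒<* : ∀ {y L M} → All (_≤* M) L → y ≺ L → y <* M
  ≺⇒<* (h ∷ _)  (here (i , refl)) = ≤*⇒sub-<* h i
  ≺⇒<* (_ ∷ hs) (there p)         = ≺⇒<* hs p

  ¬self-bounded : ∀ {L} → Acc _◁_ L → ∃ (_∈ L) → ¬ All (_<* L) L
  ¬self-bounded (acc rs) ne bounded with merge-bounds bounded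
  ... | M , ch , le , ne⇒ = ¬self-bounded (rs (ne⇒ ne , ch)) (ne⇒ ne) (All.map (≺⇒<* le) ch)

  <-irrefl : ∀ α → ¬ α < α
  <-irrefl α α<α = ¬self-bounded (◁-wellFounded [ α ]) (α , here refl) (α<α ∷ [])

  fromStar : Star → Ord
  fromStar s = S (proj₁ s) (proj₂ s)

  ≺-supStar : ∀ K (a : El K → Star) j {y} → y ≺ [ fromStar (a j) ] → y ≺ [ supStar K a ]
  ≺-supStar K a j (here (i , refl)) =
    here (Inverse.from iso (j , i) ,
          cong (λ p → proj₂ (a (proj₁ p)) (proj₂ p)) (Inverse.strictlyInverseˡ iso (j , i)))
    where iso = Σc-iso K (λ j → proj₁ (a j))

  supStar-least : ∀ K (a : El K → Star) {δ} → (∀ j m → proj₂ (a j) m < δ) → supStar K a ≤ δ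
  supStar-least K a H k = H _ _

  toStar-sub-< : ∀ {x y} (p : IsS x) (q : IsS y) → x ≤ y →
    ∀ m → proj₂ (toStar x p) m < fromStar (toStar y q)
  toStar-sub-< {𝟘}               ()
  toStar-sub-< {S _ _} {𝟘}     _ ()
  toStar-sub-< {S _ _} {S _ _} _ _ le = le

  sup-mono : ∀ {I J} {a : El I → Ord} {b : El J → Ord}
    (pa : ∀ i → IsS (a i)) (pb : ∀ j → IsS (b j)) →
    (∀ i → Σ[ j ∈ El J ] a i ≤ b j) → sup I a pa ≤ sup J b pb
  sup-mono {I} {J} {a} {b} pa pb H = supStar-least I (λ i → toStar (a i) (pa i)) λ i m →
    let j , le = H i
    in  <*-≺-mono (≺-supStar J (λ j → toStar (b j) (pb j)) j) (toStar-sub-< (pa i) (pb j) le m)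

  supSub-mono : ∀ α β (pα : IsS α) (pβ : IsS β) (e : In α ≡ In β)
    (qα : (i : In α) → IsS (sub α i)) (qβ : (i : In β) → IsS (sub β i)) →
    ((i : In α) → sub α i ≤ sub β (subst id e i)) → supSub α pα qα ≤ supSub β pβ qβ
  supSub-mono 𝟘       _       ()
  supSub-mono (S _ _) 𝟘       _ ()
  supSub-mono (S _ _) (S _ _) _ _ e qα qβ H = sup-mono qα qβ λ i → subst id e i , H i

  lookupL-∈ : ∀ ys p → lookupL ys p ∈ ys
  lookupL-∈ (_ ∷ _)  (zero  , _)      = here refl
  lookupL-∈ (_ ∷ ys) (suc n , s≤s n<) = there (lookupL-∈ ys (n , n<))

  lookupL-surjective : ∀ {ys s} → s ∈ ys → ∃ λ p → lookupL ys p ≡ s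
  lookupL-surjective (here refl) = (zero , s≤s z≤n) , refl
  lookupL-surjective (there m)   =
    let (n , n<) , eq = lookupL-surjective m in (suc n , s≤s n<) , eq

  ≺-supStars : ∀ ys {s y} → s ∈ ys → y ≺ [ fromStar s ] → y ≺ [ supStars ys ]
  ≺-supStars ys@(_ ∷ _) m p with lookupL-surjective m
  ... | q , refl =
    ≺-supStar (ℕ<c (length ys)) (λ j → lookupL ys (Inverse.to iso j)) (Inverse.from iso q)
      (subst (λ t → _ ≺ [ fromStar (lookupL ys t) ]) (sym (Inverse.strictlyInverseˡ iso q)) p)
    where iso = ℕ<c-iso (length ys)

  supStars-least : ∀ ys {δ} → (∀ {s} → s ∈ ys → ∀ m → proj₂ s m < δ) → supStars ys ≤ δ
  supStars-least []         _ = tt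
  supStars-least ys@(_ ∷ _) {δ} H =
    supStar-least (ℕ<c (length ys)) (λ j → lookupL ys (Inverse.to iso j)) {δ} λ j →
      H (lookupL-∈ ys (Inverse.to iso j))
    where iso = ℕ<c-iso (length ys)

  stars-∷ : ∀ β {βs} → stars βs ⊆ stars (β ∷ βs)
  stars-∷ 𝟘       m = m
  stars-∷ (S _ _) m = there m

  ≮𝟘 : ∀ {x} → ¬ x < 𝟘
  ≮𝟘 ((() ∷ _ , _) , _)
  ≮𝟘 (([] , _) , inj₁ () , _)
  ≮𝟘 (([] , _) , inj₂ () , _)

  stars-bounded : ∀ {αs βs} → Pointwise _≤_ αs βs → ∀ {s} → s ∈ stars αs → ∀ m →
    Σ[ s' ∈ Star ] s' ∈ stars βs × proj₂ s m < fromStar s'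
  stars-bounded {𝟘 ∷ _} {β ∷ _} (_ ∷ rs) m i =
    let s' , m' , lt = stars-bounded rs m i in s' , stars-∷ β m' , lt
  stars-bounded {S _ _ ∷ _} {β ∷ _} (_ ∷ rs) (there m) i =
    let s' , m' , lt = stars-bounded rs m i in s' , stars-∷ β m' , lt
  stars-bounded {S _ _ ∷ _} {𝟘 ∷ _}     (r ∷ _) (here refl) i = ⊥-elim (≮𝟘 (r i))
  stars-bounded {S _ _ ∷ _} {S J g ∷ _} (r ∷ _) (here refl) i = (J , g) , here refl , r i

  supFin-mono : ∀ αs βs → Pointwise _≤_ αs βs → supFin αs ≤ supFin βs
  supFin-mono αs βs pw = supStars-least (stars αs) λ m i →
    let s' , m' , lt = stars-bounded pw m i in <*-≺-mono (≺-supStars (stars βs) m') lt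

lemma3p16 : (𝔉 : IndexSets) → let open OrdTheory 𝔉 in
    -- (1)
    ((α β : Ord) (e : In α ≡ In β) →
       ((i : In α) → sub α i ≤ sub β (subst id e i)) → α ≤ β)
    -- (2) sups of families in ord*
    × ((α β : Ord) (pα : IsS α) (pβ : IsS β) (e : In α ≡ In β)
       (qα : (i : In α) → IsS (sub α i)) (qβ : (i : In β) → IsS (sub β i)) →
       ((i : In α) → sub α i ≤ sub β (subst id e i)) →
       supSub α pα qα ≤ supSub β pβ qβ)
    -- (2) sups of finite families in ord
    × ((αs βs : List Ord) → Pointwise _≤_ αs βs → supFin αs ≤ supFin βs)
    -- (3)
    × ((α : Ord) → α ≤ α)
    × ((α : Ord) (βs : List Ord) → α ≤* (α ∷ βs))
    -- (4)
    × ((α : Ord) → IsS α → (i : In α) → sub α i < α)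
    × ((α : Ord) → IsS α → (i : In α) (βs : List Ord) → sub α i <* (α ∷ βs))
    -- (5)
    × ((α : Ord) → ¬ (α < α))
    -- (6)
    × ((α : Ord) → α < sucO α)
    -- (7)
    × ((α β : Ord) → ((γ : Ord) → γ < α → γ < β) → α ≤ β)
lemma3p16 𝔉 =
  ≤-pointwise , supSub-mono , supFin-mono ,
  ≤-refl , ≤*-head ,
  (λ α _ i → sub-<*-head α i []) , (λ α _ → sub-<*-head α) ,
  <-irrefl , <-suc , <-⊆⇒≤
  where open OrdProperties 𝔉
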